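{- Consider unlabeled forests $\mathsf{F},\mathsf{G}$, a joint labeling $\lambda$ of them, a tree alignment $\mathcal{A} \in \mathsf{TA}(\mathsf{F},\mathsf{G})$, and an integer $d\in \mathbb{Z}_{+}$. Then $\mathsf{ted}_{\mathsf{L}(\lambda,d),\mathcal{A}}(\mathsf{F},\mathsf{G})\le d\cdot \mathsf{ted}_{\lambda,\mathcal{A}}(\mathsf{F},\mathsf{G})$.
   Context: A forest is a possibly empty sequence of non-empty rooted ordered trees. $\mathsf{F},\mathsf{G}$ have disjoint node sets $V_\mathsf{F},V_\mathsf{G}$; a joint labeling is a map $\lambda:V_\mathsf{F}\cup V_\mathsf{G}\to\Sigma$ for an integer alphabet $\Sigma$. Parentheses representation: if $\mathsf{F}$ consists of trees $T_1,\dots,T_m$ with roots $v_i$ and $\mathsf{F}_i$ the forest of descendants of $v_i$, then $P_\lambda(\mathsf{F})=\bigodot_{i}\big(\texttt{(}_{\lambda(v_i)}P_\lambda(\mathsf{F}_i)\texttt{)}_{\lambda(v_i)}\big)$; $P(\mathsf{F})$ is the same string with labels dropped; $o_\mathsf{F}(u),c_\mathsf{F}(u)$ are the positions of the opening/closing parenthesis of node $u$. An alignment of string $X$ onto $Y$ is a sequence $(x_t,y_t)_{t=0}^m$ with $(x_0,y_0)=(0,0)$, $(x_m,y_m)=(|X|,|Y|)$, steps in $\{(1,1),(1,0),(0,1)\}$; $(1,0)$ deletes $X[x_t]$, $(0,1)$ inserts $Y[y_t]$, $(1,1)$ aligns $X[x_t]$ with $Y[y_t]$ (substitution if different). Cost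 $\mathsf{ed}_\mathcal{A}(X,Y)$: number of deletions, insertions, substitutions. $\mathsf{TA}(\mathsf{F},\mathsf{G})$: alignments of $P(\mathsf{F})$ onto $P(\mathsf{G})$ such that each node $u\in V_\mathsf{F}$ either has both parentheses deleted or has its opening and closing parentheses aligned with the opening and closing parentheses, respectively, of one node $v\in V_\mathsf{G}$. For a joint labeling $\mu$, $\mathsf{ted}_{\mu,\mathcal{A}}(\mathsf{F},\mathsf{G})=\tfrac12\mathsf{ed}_\mathcal{A}(P_\mu(\mathsf{F}),P_\mu(\mathsf{G}))$. Look-ahead refinement: $\mathsf{sub}_{<d}(v)$ is the subtree rooted at $v$ restricted to nodes at distance less than $d$ from $v$; $\mathsf{L}(\lambda,d)$ is any joint labeling $\lambda'$ such that $\lambda'(u)=\lambda'(v)$ iff $P_\lambda(\mathsf{sub}_{<d}(u))=P_\lambda(\mathsf{sub}_{<d}(v))$. -}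

module Defs where

open import Data.Nat using (ℕ; zero; suc; _+_; _*_; _≟_)
open import Data.List using (List; []; _∷_; _++_; length)
open import Data.Product using (_×_; _,_; Σ-syntax)
open import Data.Sum using (_⊎_; inj₁; inj₂)
open import Data.Bool using (Bool; true; false)
open import Data.Integer using (+_)
open import Data.Rational using (ℚ; _/_)
open import Relation.Nullary using (yes; no)
open import Relation.Binary.PropositionalEquality using (_≡_)
open import Function using (_∘_; _⇔_)

data Tree : Set where
  node : List Tree → Tree

Forest : Set
Forest = List Tree

data Node : Forest → Set where
  root   : ∀ {cs ts} → Node (node cs ∷ ts)
  inside : ∀ {cs ts} → Node cs → Node (node cs ∷ ts)
  later  : ∀ {t ts} → Node ts → Node (t ∷ ts)

mutual
  size : Forest → ℕ
  size [] = 0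
  size (t ∷ ts) = sizeT t + size ts

  sizeT : Tree → ℕ
  sizeT (node cs) = suc (size cs)

data Bracket : Set where
  opn cls : Bracket

P : Forest → List Bracket
P [] = []
P (node cs ∷ ts) = opn ∷ P cs ++ cls ∷ P ts

-- Positions (0-based) of the opening / closing parenthesis of a node in P(F).
oF : ∀ {F} → Node F → ℕ
oF root = 0
oF (inside u) = suc (oF u)
oF (later {node cs} u) = 2 * size cs + 2 + oF u

cF : ∀ {F} → Node F → ℕ
cF {node cs ∷ _} root = suc (2 * size cs)
cF (inside u) = suc (cF u)
cF (later {node cs} u) = 2 * size cs + 2 + cF u

-- Labeled symbols: (_a or )_a.
Sym : Set
Sym = Bracket × ℕ

_≟B_ : Bracket → Bracket → Bool
opn ≟B opn = true
cls ≟B cls = true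
_ ≟B _ = false

_≟S_ : Sym → Sym → Bool
(b , a) ≟S (b' , a') with b ≟B b' | a ≟ a'
... | true | yes _ = true
... | _    | _     = false

data LTree : Set where
  lnode : ℕ → List LTree → LTree

mutual
  PL : List LTree → List Sym
  PL [] = []
  PL (t ∷ ts) = PLT t ++ PL ts

  PLT : LTree → List Sym
  PLT (lnode a cs) = (opn , a) ∷ PL cs ++ (cls , a) ∷ []

label : (F : Forest) → (Node F → ℕ) → List LTree
label [] λ₀ = []
label (node cs ∷ ts) λ₀ = lnode (λ₀ root) (label cs (λ₀ ∘ inside)) ∷ label ts (λ₀ ∘ later)

Pλ : (F : Forest) → (Node F → ℕ) → List Sym
Pλ F λ₀ = PL (label F λ₀)

subtree : (F : Forest) → (Node F → ℕ) → Node F → LTree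
subtree (node cs ∷ ts) λ₀ root = lnode (λ₀ root) (label cs (λ₀ ∘ inside))
subtree (node cs ∷ ts) λ₀ (inside u) = subtree cs (λ₀ ∘ inside) u
subtree (t ∷ ts) λ₀ (later u) = subtree ts (λ₀ ∘ later) u

-- Restriction of a labeled forest to nodes at depth < d (roots have depth 0).
mutual
  trunc : ℕ → List LTree → List LTree
  trunc zero _ = []
  trunc (suc d) ts = truncs d ts

  truncs : ℕ → List LTree → List LTree
  truncs d [] = []
  truncs d (lnode a cs ∷ ts) = lnode a (trunc d cs) ∷ truncs d ts

subP : (F : Forest) → (Node F → ℕ) → ℕ → Node F → List Sym
subP F λ₀ d u = PL (trunc d (subtree F λ₀ u ∷ []))

JNode : Forest → Forest → Set
JNode F G = Node F ⊎ Node G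

Labeling : Forest → Forest → Set
Labeling F G = JNode F G → ℕ

jsubP : (F G : Forest) → Labeling F G → ℕ → JNode F G → List Sym
jsubP F G λ₀ d (inj₁ u) = subP F (λ₀ ∘ inj₁) d u
jsubP F G λ₀ d (inj₂ v) = subP G (λ₀ ∘ inj₂) d v

-- λ' is a valid choice of L(λ,d).
IsLookAhead : (F G : Forest) → Labeling F G → ℕ → Labeling F G → Set
IsLookAhead F G λ₀ d λ' =
  ∀ (u v : JNode F G) → (λ' u ≡ λ' v) ⇔ (jsubP F G λ₀ d u ≡ jsubP F G λ₀ d v)

-- Alignments of a string of length m onto a string of length n,
-- represented by their step sequence starting from (0,0).

data Alignment : ℕ → ℕ → Set where
  done : Alignment 0 0
  match : ∀ {m n} → Alignment m n → Alignment (suc m) (suc n)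
  del   : ∀ {m n} → Alignment m n → Alignment (suc m) n
  ins   : ∀ {m n} → Alignment m n → Alignment m (suc n)

data AlignedAt : ∀ {m n} → Alignment m n → ℕ → ℕ → Set where
  here  : ∀ {m n} {A : Alignment m n} → AlignedAt (match A) 0 0
  thM   : ∀ {m n x y} {A : Alignment m n} → AlignedAt A x y → AlignedAt (match A) (suc x) (suc y)
  thD   : ∀ {m n x y} {A : Alignment m n} → AlignedAt A x y → AlignedAt (del A) (suc x) y
  thI   : ∀ {m n x y} {A : Alignment m n} → AlignedAt A x y → AlignedAt (ins A) x (suc y)

data DeletedAt : ∀ {m n} → Alignment m n → ℕ → Set where
  here : ∀ {m n} {A : Alignment m n} → DeletedAt (del A) 0
  thM  : ∀ {m n x} {A : Alignment m n} → DeletedAt A x → DeletedAt (match A) (suc x)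
  thD  : ∀ {m n x} {A : Alignment m n} → DeletedAt A x → DeletedAt (del A) (suc x)
  thI  : ∀ {m n x} {A : Alignment m n} → DeletedAt A x → DeletedAt (ins A) x

-- ed_A(X,Y): deletions + insertions + substitutions.
-- (Mismatched-length cases never arise for strings of the indexed lengths.)
ed : ∀ {m n} → Alignment m n → List Sym → List Sym → ℕ
ed done _ _ = 0
ed (match A) (a ∷ X) (b ∷ Y) with a ≟S b
... | true  = ed A X Y
... | false = suc (ed A X Y)
ed (match A) _ _ = 0
ed (del A) (a ∷ X) Y = suc (ed A X Y)
ed (del A) [] _ = 0
ed (ins A) X (b ∷ Y) = suc (ed A X Y)
ed (ins A) _ [] = 0

Align : Forest → Forest → Set
Align F G = Alignment (length (P F)) (length (P G))

IsTreeAlignment : (F G : Forest) → Align F G → Set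
IsTreeAlignment F G A =
  ∀ (u : Node F) →
    (DeletedAt A (oF u) × DeletedAt A (cF u))
    ⊎ (Σ[ v ∈ Node G ] (AlignedAt A (oF u) (oF v) × AlignedAt A (cF u) (cF v)))

ted : (F G : Forest) → Labeling F G → Align F G → ℚ
ted F G μ A = (+ ed A (Pλ F (μ ∘ inj₁)) (Pλ G (μ ∘ inj₂))) / 2

-- A tree alignment is an edit script on the forests: deleting or inserting a node costs its two
-- parentheses, and matching two nodes costs both of theirs exactly when their labels differ, so
-- under any labelling the alignment costs twice the number of deletions, insertions and label
-- mismatches of the script.  Under a look-ahead labelling a matched pair mismatches only if the
-- look-ahead windows of its nodes differ, which needs a deletion, insertion or mismatch among the
-- pairs at most d - 1 levels below it.  Each operation lies in the windows of at most d pairs on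
-- its path to the roots, so the look-ahead cost is at most d times the original one.

module Submission where

open import Defs

module EditScripts where

  open import Data.Nat using (ℕ; zero; suc; _+_; _*_; _≤_; _<_; z≤n; s≤s; _∸_; _⊓_) renaming (_≟_ to _≟ℕ_)
  open import Data.Nat.Properties
  open import Data.Nat.Tactic.RingSolver using (solve-∀)
  open import Algebra.Properties.CommutativeSemigroup +-commutativeSemigroup
    using () renaming (interchange to +-interchange)
  open import Algebra.Properties.CommutativeSemigroup *-commutativeSemigroup
    using () renaming (x∙yz≈y∙xz to *-left-comm)
  open import Data.List using (List; []; _∷_; _++_; length; drop)
  open import Data.List.Properties using (drop-drop; length-++; ++-assoc; ≡-dec)
  open import Data.Product.Properties using () renaming (≡-dec to ×-≡-dec)
  open import Data.Product using (_×_; _,_; Σ-syntax; ∃-syntax; proj₁; proj₂)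
  open import Data.Sum using (_⊎_; inj₁; inj₂; [_,_])
  import Data.Sum as Sum
  open import Data.Empty using (⊥; ⊥-elim)
  open import Data.Bool using (true; false)
  open import Function using (_∘_; Equivalence)
  open import Relation.Binary.PropositionalEquality hiding ([_])
  open import Relation.Binary.Definitions using (DecidableEquality; tri<; tri≈; tri>)
  open import Relation.Nullary using (Dec; yes; no)

  -- Alignments as step lists

  data Step : Set where
    M D I : Step

  srcLen tgtLen : List Step → ℕ
  srcLen [] = 0
  srcLen (M ∷ σ) = suc (srcLen σ)
  srcLen (D ∷ σ) = suc (srcLen σ)
  srcLen (I ∷ σ) = srcLen σ
  tgtLen [] = 0
  tgtLen (M ∷ σ) = suc (tgtLen σ)
  tgtLen (D ∷ σ) = tgtLen σ
  tgtLen (I ∷ σ) = suc (tgtLen σ)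

  data Aligned : List Step → ℕ → ℕ → Set where
    here : ∀ {σ} → Aligned (M ∷ σ) 0 0
    M∷_  : ∀ {σ x y} → Aligned σ x y → Aligned (M ∷ σ) (suc x) (suc y)
    D∷_  : ∀ {σ x y} → Aligned σ x y → Aligned (D ∷ σ) (suc x) y
    I∷_  : ∀ {σ x y} → Aligned σ x y → Aligned (I ∷ σ) x (suc y)

  data Deleted : List Step → ℕ → Set where
    here : ∀ {σ} → Deleted (D ∷ σ) 0
    M∷_  : ∀ {σ x} → Deleted σ x → Deleted (M ∷ σ) (suc x)
    D∷_  : ∀ {σ x} → Deleted σ x → Deleted (D ∷ σ) (suc x)
    I∷_  : ∀ {σ x} → Deleted σ x → Deleted (I ∷ σ) x

  data Inserted : List Step → ℕ → Set where
    here : ∀ {σ} → Inserted (I ∷ σ) 0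
    M∷_  : ∀ {σ y} → Inserted σ y → Inserted (M ∷ σ) (suc y)
    D∷_  : ∀ {σ y} → Inserted σ y → Inserted (D ∷ σ) y
    I∷_  : ∀ {σ y} → Inserted σ y → Inserted (I ∷ σ) (suc y)

  mismatch : Sym → Sym → ℕ
  mismatch a b with a ≟S b
  ... | true = 0
  ... | false = 1

  -- The default symbol makes editCost total; it is never read for lists of the right lengths.
  first : List Sym → Sym
  first [] = (opn , 0)
  first (a ∷ _) = a

  editCost : List Step → List Sym → List Sym → ℕ
  editCost [] X Y = 0
  editCost (M ∷ σ) X Y = mismatch (first X) (first Y) + editCost σ (drop 1 X) (drop 1 Y)
  editCost (D ∷ σ) X Y = suc (editCost σ (drop 1 X) Y)
  editCost (I ∷ σ) X Y = suc (editCost σ X (drop 1 Y))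

  removeAt : ℕ → List Sym → List Sym
  removeAt zero X = drop 1 X
  removeAt (suc p) [] = []
  removeAt (suc p) (a ∷ X) = a ∷ removeAt p X

  removeAt-[] : ∀ p → removeAt p [] ≡ []
  removeAt-[] zero = refl
  removeAt-[] (suc p) = refl

  withoutDeletion : ∀ {σ p} → Deleted σ p → List Step
  withoutDeletion {D ∷ σ} here = σ
  withoutDeletion (M∷ δ) = M ∷ withoutDeletion δ
  withoutDeletion (D∷ δ) = D ∷ withoutDeletion δ
  withoutDeletion (I∷ δ) = I ∷ withoutDeletion δ

  withoutInsertion : ∀ {σ p} → Inserted σ p → List Step
  withoutInsertion {I ∷ σ} here = σ
  withoutInsertion (M∷ ι) = M ∷ withoutInsertion ι
  withoutInsertion (D∷ ι) = D ∷ withoutInsertion ι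
  withoutInsertion (I∷ ι) = I ∷ withoutInsertion ι

  srcLen-withoutDeletion : ∀ {σ p} (δ : Deleted σ p) → suc (srcLen (withoutDeletion δ)) ≡ srcLen σ
  srcLen-withoutDeletion here = refl
  srcLen-withoutDeletion (M∷ δ) = cong suc (srcLen-withoutDeletion δ)
  srcLen-withoutDeletion (D∷ δ) = cong suc (srcLen-withoutDeletion δ)
  srcLen-withoutDeletion (I∷ δ) = srcLen-withoutDeletion δ

  tgtLen-withoutDeletion : ∀ {σ p} (δ : Deleted σ p) → tgtLen (withoutDeletion δ) ≡ tgtLen σ
  tgtLen-withoutDeletion here = refl
  tgtLen-withoutDeletion (M∷ δ) = cong suc (tgtLen-withoutDeletion δ)
  tgtLen-withoutDeletion (D∷ δ) = tgtLen-withoutDeletion δ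
  tgtLen-withoutDeletion (I∷ δ) = cong suc (tgtLen-withoutDeletion δ)

  length-withoutDeletion : ∀ {σ p} (δ : Deleted σ p) → suc (length (withoutDeletion δ)) ≡ length σ
  length-withoutDeletion here = refl
  length-withoutDeletion (M∷ δ) = cong suc (length-withoutDeletion δ)
  length-withoutDeletion (D∷ δ) = cong suc (length-withoutDeletion δ)
  length-withoutDeletion (I∷ δ) = cong suc (length-withoutDeletion δ)

  srcLen-withoutInsertion : ∀ {σ p} (ι : Inserted σ p) → srcLen (withoutInsertion ι) ≡ srcLen σ
  srcLen-withoutInsertion here = refl
  srcLen-withoutInsertion (M∷ ι) = cong suc (srcLen-withoutInsertion ι)
  srcLen-withoutInsertion (D∷ ι) = cong suc (srcLen-withoutInsertion ι)
  srcLen-withoutInsertion (I∷ ι) = srcLen-withoutInsertion ι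

  tgtLen-withoutInsertion : ∀ {σ p} (ι : Inserted σ p) → suc (tgtLen (withoutInsertion ι)) ≡ tgtLen σ
  tgtLen-withoutInsertion here = refl
  tgtLen-withoutInsertion (M∷ ι) = cong suc (tgtLen-withoutInsertion ι)
  tgtLen-withoutInsertion (D∷ ι) = tgtLen-withoutInsertion ι
  tgtLen-withoutInsertion (I∷ ι) = cong suc (tgtLen-withoutInsertion ι)

  length-withoutInsertion : ∀ {σ p} (ι : Inserted σ p) → suc (length (withoutInsertion ι)) ≡ length σ
  length-withoutInsertion here = refl
  length-withoutInsertion (M∷ ι) = cong suc (length-withoutInsertion ι)
  length-withoutInsertion (D∷ ι) = cong suc (length-withoutInsertion ι)
  length-withoutInsertion (I∷ ι) = cong suc (length-withoutInsertion ι)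

  editCost-withoutDeletion : ∀ {σ p} (δ : Deleted σ p) X Y →
    editCost σ X Y ≡ suc (editCost (withoutDeletion δ) (removeAt p X) Y)
  editCost-withoutDeletion here X Y = refl
  editCost-withoutDeletion (M∷_ {x = p} δ) [] Y
    rewrite editCost-withoutDeletion δ [] (drop 1 Y) | removeAt-[] p = +-suc _ _
  editCost-withoutDeletion (M∷ δ) (a ∷ X) Y
    rewrite editCost-withoutDeletion δ X (drop 1 Y) = +-suc _ _
  editCost-withoutDeletion (D∷_ {x = p} δ) [] Y
    rewrite editCost-withoutDeletion δ [] Y | removeAt-[] p = refl
  editCost-withoutDeletion (D∷ δ) (a ∷ X) Y = cong suc (editCost-withoutDeletion δ X Y)
  editCost-withoutDeletion (I∷ δ) X Y = cong suc (editCost-withoutDeletion δ X (drop 1 Y))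

  editCost-withoutInsertion : ∀ {σ p} (ι : Inserted σ p) X Y →
    editCost σ X Y ≡ suc (editCost (withoutInsertion ι) X (removeAt p Y))
  editCost-withoutInsertion here X Y = refl
  editCost-withoutInsertion (M∷_ {y = p} ι) X []
    rewrite editCost-withoutInsertion ι (drop 1 X) [] | removeAt-[] p = +-suc _ _
  editCost-withoutInsertion (M∷ ι) X (b ∷ Y)
    rewrite editCost-withoutInsertion ι (drop 1 X) Y = +-suc _ _
  editCost-withoutInsertion (D∷ ι) X Y = cong suc (editCost-withoutInsertion ι (drop 1 X) Y)
  editCost-withoutInsertion (I∷_ {y = p} ι) X []
    rewrite editCost-withoutInsertion ι X [] | removeAt-[] p = refl
  editCost-withoutInsertion (I∷ ι) X (b ∷ Y) = cong suc (editCost-withoutInsertion ι X Y)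

  Aligned-withoutDeletion-before : ∀ {σ p x y} (δ : Deleted σ p) → Aligned σ x y → x < p →
    Aligned (withoutDeletion δ) x y
  Aligned-withoutDeletion-before (M∷ δ) here _ = here
  Aligned-withoutDeletion-before (M∷ δ) (M∷ a) (s≤s x<p) = M∷ Aligned-withoutDeletion-before δ a x<p
  Aligned-withoutDeletion-before (D∷ δ) (D∷ a) (s≤s x<p) = D∷ Aligned-withoutDeletion-before δ a x<p
  Aligned-withoutDeletion-before (I∷ δ) (I∷ a) x<p = I∷ Aligned-withoutDeletion-before δ a x<p

  Aligned-withoutDeletion-after : ∀ {σ p k y} (δ : Deleted σ p) → Aligned σ (suc (p + k)) y →
    Aligned (withoutDeletion δ) (p + k) y
  Aligned-withoutDeletion-after here (D∷ a) = a
  Aligned-withoutDeletion-after (M∷ δ) (M∷ a) = M∷ Aligned-withoutDeletion-after δ a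
  Aligned-withoutDeletion-after (D∷ δ) (D∷ a) = D∷ Aligned-withoutDeletion-after δ a
  Aligned-withoutDeletion-after (I∷ δ) (I∷ a) = I∷ Aligned-withoutDeletion-after δ a

  Deleted-withoutDeletion-before : ∀ {σ p x} (δ : Deleted σ p) → Deleted σ x → x < p →
    Deleted (withoutDeletion δ) x
  Deleted-withoutDeletion-before (M∷ δ) (M∷ a) (s≤s x<p) = M∷ Deleted-withoutDeletion-before δ a x<p
  Deleted-withoutDeletion-before (D∷ δ) here _ = here
  Deleted-withoutDeletion-before (D∷ δ) (D∷ a) (s≤s x<p) = D∷ Deleted-withoutDeletion-before δ a x<p
  Deleted-withoutDeletion-before (I∷ δ) (I∷ a) x<p = I∷ Deleted-withoutDeletion-before δ a x<p

  Deleted-withoutDeletion-after : ∀ {σ p k} (δ : Deleted σ p) → Deleted σ (suc (p + k)) →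
    Deleted (withoutDeletion δ) (p + k)
  Deleted-withoutDeletion-after here (D∷ a) = a
  Deleted-withoutDeletion-after (M∷ δ) (M∷ a) = M∷ Deleted-withoutDeletion-after δ a
  Deleted-withoutDeletion-after (D∷ δ) (D∷ a) = D∷ Deleted-withoutDeletion-after δ a
  Deleted-withoutDeletion-after (I∷ δ) (I∷ a) = I∷ Deleted-withoutDeletion-after δ a

  Aligned-withoutInsertion-before : ∀ {σ p x y} (ι : Inserted σ p) → Aligned σ x y → y < p →
    Aligned (withoutInsertion ι) x y
  Aligned-withoutInsertion-before (M∷ ι) here _ = here
  Aligned-withoutInsertion-before (M∷ ι) (M∷ a) (s≤s y<p) = M∷ Aligned-withoutInsertion-before ι a y<p
  Aligned-withoutInsertion-before (D∷ ι) (D∷ a) y<p = D∷ Aligned-withoutInsertion-before ι a y<p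
  Aligned-withoutInsertion-before (I∷ ι) (I∷ a) (s≤s y<p) = I∷ Aligned-withoutInsertion-before ι a y<p

  Aligned-withoutInsertion-after : ∀ {σ p k x} (ι : Inserted σ p) → Aligned σ x (suc (p + k)) →
    Aligned (withoutInsertion ι) x (p + k)
  Aligned-withoutInsertion-after here (I∷ a) = a
  Aligned-withoutInsertion-after (M∷ ι) (M∷ a) = M∷ Aligned-withoutInsertion-after ι a
  Aligned-withoutInsertion-after (D∷ ι) (D∷ a) = D∷ Aligned-withoutInsertion-after ι a
  Aligned-withoutInsertion-after (I∷ ι) (I∷ a) = I∷ Aligned-withoutInsertion-after ι a

  Deleted-withoutInsertion : ∀ {σ p x} (ι : Inserted σ p) → Deleted σ x → Deleted (withoutInsertion ι) x
  Deleted-withoutInsertion here (I∷ a) = a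
  Deleted-withoutInsertion (M∷ ι) (M∷ a) = M∷ Deleted-withoutInsertion ι a
  Deleted-withoutInsertion (D∷ ι) here = here
  Deleted-withoutInsertion (D∷ ι) (D∷ a) = D∷ Deleted-withoutInsertion ι a
  Deleted-withoutInsertion (I∷ ι) (I∷ a) = I∷ Deleted-withoutInsertion ι a

  Aligned-bounded : ∀ {σ x y} → Aligned σ x y → x < srcLen σ × y < tgtLen σ
  Aligned-bounded here = s≤s z≤n , s≤s z≤n
  Aligned-bounded (M∷ a) = let x< , y< = Aligned-bounded a in s≤s x< , s≤s y<
  Aligned-bounded (D∷ a) = let x< , y< = Aligned-bounded a in s≤s x< , y<
  Aligned-bounded (I∷ a) = let x< , y< = Aligned-bounded a in x< , s≤s y<

  Aligned-functional : ∀ {σ x y y'} → Aligned σ x y → Aligned σ x y' → y ≡ y'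
  Aligned-functional here here = refl
  Aligned-functional (M∷ a) (M∷ b) = cong suc (Aligned-functional a b)
  Aligned-functional (D∷ a) (D∷ b) = Aligned-functional a b
  Aligned-functional (I∷ a) (I∷ b) = cong suc (Aligned-functional a b)

  Deleted⇒¬Aligned : ∀ {σ x y} → Deleted σ x → Aligned σ x y → ⊥
  Deleted⇒¬Aligned (M∷ δ) (M∷ a) = Deleted⇒¬Aligned δ a
  Deleted⇒¬Aligned (D∷ δ) (D∷ a) = Deleted⇒¬Aligned δ a
  Deleted⇒¬Aligned (I∷ δ) (I∷ a) = Deleted⇒¬Aligned δ a

  Aligned-or-Inserted : ∀ σ {y} → y < tgtLen σ → (∃[ x ] Aligned σ x y) ⊎ Inserted σ y
  Aligned-or-Inserted (M ∷ σ) {zero} _ = inj₁ (0 , here)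
  Aligned-or-Inserted (M ∷ σ) {suc y} (s≤s y<) with Aligned-or-Inserted σ y<
  ... | inj₁ (x , a) = inj₁ (suc x , M∷ a)
  ... | inj₂ ι = inj₂ (M∷ ι)
  Aligned-or-Inserted (D ∷ σ) y< with Aligned-or-Inserted σ y<
  ... | inj₁ (x , a) = inj₁ (suc x , D∷ a)
  ... | inj₂ ι = inj₂ (D∷ ι)
  Aligned-or-Inserted (I ∷ σ) {zero} _ = inj₂ here
  Aligned-or-Inserted (I ∷ σ) {suc y} (s≤s y<) with Aligned-or-Inserted σ y<
  ... | inj₁ (x , a) = inj₁ (x , I∷ a)
  ... | inj₂ ι = inj₂ (I∷ ι)

  srcLen-++ : ∀ σ τ → srcLen (σ ++ τ) ≡ srcLen σ + srcLen τ
  srcLen-++ [] τ = refl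
  srcLen-++ (M ∷ σ) τ = cong suc (srcLen-++ σ τ)
  srcLen-++ (D ∷ σ) τ = cong suc (srcLen-++ σ τ)
  srcLen-++ (I ∷ σ) τ = srcLen-++ σ τ

  tgtLen-++ : ∀ σ τ → tgtLen (σ ++ τ) ≡ tgtLen σ + tgtLen τ
  tgtLen-++ [] τ = refl
  tgtLen-++ (M ∷ σ) τ = cong suc (tgtLen-++ σ τ)
  tgtLen-++ (D ∷ σ) τ = tgtLen-++ σ τ
  tgtLen-++ (I ∷ σ) τ = cong suc (tgtLen-++ σ τ)

  Aligned-split : ∀ {σ x y} → Aligned σ x y →
    ∃[ σ₁ ] ∃[ σ₂ ] σ ≡ σ₁ ++ M ∷ σ₂ × srcLen σ₁ ≡ x × tgtLen σ₁ ≡ y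
  Aligned-split (here {σ}) = [] , σ , refl , refl , refl
  Aligned-split (M∷ a) with Aligned-split a
  ... | σ₁ , σ₂ , refl , refl , refl = M ∷ σ₁ , σ₂ , refl , refl , refl
  Aligned-split (D∷ a) with Aligned-split a
  ... | σ₁ , σ₂ , refl , refl , refl = D ∷ σ₁ , σ₂ , refl , refl , refl
  Aligned-split (I∷ a) with Aligned-split a
  ... | σ₁ , σ₂ , refl , refl , refl = I ∷ σ₁ , σ₂ , refl , refl , refl

  Aligned-prefix : ∀ σ {τ x y} → Aligned (σ ++ τ) x y → x < srcLen σ → Aligned σ x y
  Aligned-prefix (M ∷ σ) here _ = here
  Aligned-prefix (M ∷ σ) (M∷ a) (s≤s x<) = M∷ Aligned-prefix σ a x<
  Aligned-prefix (D ∷ σ) (D∷ a) (s≤s x<) = D∷ Aligned-prefix σ a x<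
  Aligned-prefix (I ∷ σ) (I∷ a) x< = I∷ Aligned-prefix σ a x<

  Deleted-prefix : ∀ σ {τ x} → Deleted (σ ++ τ) x → x < srcLen σ → Deleted σ x
  Deleted-prefix (M ∷ σ) (M∷ a) (s≤s x<) = M∷ Deleted-prefix σ a x<
  Deleted-prefix (D ∷ σ) here _ = here
  Deleted-prefix (D ∷ σ) (D∷ a) (s≤s x<) = D∷ Deleted-prefix σ a x<
  Deleted-prefix (I ∷ σ) (I∷ a) x< = I∷ Deleted-prefix σ a x<

  Aligned-suffix : ∀ σ₁ {σ₂ x y} → Aligned (σ₁ ++ M ∷ σ₂) (srcLen σ₁ + suc x) y →
    ∃[ y' ] y ≡ tgtLen σ₁ + suc y' × Aligned σ₂ x y'
  Aligned-suffix [] (M∷ a) = _ , refl , a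
  Aligned-suffix (M ∷ σ₁) (M∷ a) with Aligned-suffix σ₁ a
  ... | y' , refl , b = y' , refl , b
  Aligned-suffix (D ∷ σ₁) (D∷ a) = Aligned-suffix σ₁ a
  Aligned-suffix (I ∷ σ₁) (I∷ a) with Aligned-suffix σ₁ a
  ... | y' , refl , b = y' , refl , b

  Deleted-suffix : ∀ σ₁ {σ₂ x} → Deleted (σ₁ ++ M ∷ σ₂) (srcLen σ₁ + suc x) → Deleted σ₂ x
  Deleted-suffix [] (M∷ a) = a
  Deleted-suffix (M ∷ σ₁) (M∷ a) = Deleted-suffix σ₁ a
  Deleted-suffix (D ∷ σ₁) (D∷ a) = Deleted-suffix σ₁ a
  Deleted-suffix (I ∷ σ₁) (I∷ a) = Deleted-suffix σ₁ a

  editCost-++ : ∀ σ τ X Y →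
    editCost (σ ++ τ) X Y ≡ editCost σ X Y + editCost τ (drop (srcLen σ) X) (drop (tgtLen σ) Y)
  editCost-++ [] τ X Y = refl
  editCost-++ (M ∷ σ) τ X Y
    rewrite editCost-++ σ τ (drop 1 X) (drop 1 Y) | drop-drop 1 (srcLen σ) X | drop-drop 1 (tgtLen σ) Y =
    sym (+-assoc (mismatch (first X) (first Y)) _ _)
  editCost-++ (D ∷ σ) τ X Y rewrite editCost-++ σ τ (drop 1 X) Y | drop-drop 1 (srcLen σ) X = refl
  editCost-++ (I ∷ σ) τ X Y rewrite editCost-++ σ τ X (drop 1 Y) | drop-drop 1 (tgtLen σ) Y = refl

  editCost-prefix : ∀ σ X X' Y Y' → srcLen σ ≡ length X → tgtLen σ ≡ length Y →
    editCost σ (X ++ X') (Y ++ Y') ≡ editCost σ X Y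
  editCost-prefix [] X X' Y Y' _ _ = refl
  editCost-prefix (M ∷ σ) (a ∷ X) X' (b ∷ Y) Y' eX eY =
    cong (mismatch a b +_) (editCost-prefix σ X X' Y Y' (suc-injective eX) (suc-injective eY))
  editCost-prefix (D ∷ σ) (a ∷ X) X' Y Y' eX eY = cong suc (editCost-prefix σ X X' Y Y' (suc-injective eX) eY)
  editCost-prefix (I ∷ σ) X X' (b ∷ Y) Y' eX eY = cong suc (editCost-prefix σ X X' Y Y' eX (suc-injective eY))

  twice-size-∷ : ∀ cs ts → 2 * size (node cs ∷ ts) ≡ 2 * size cs + 2 + 2 * size ts
  twice-size-∷ cs ts = arith (size cs) (size ts)
    where
    arith : ∀ a b → 2 * (suc a + b) ≡ 2 * a + 2 + 2 * b
    arith = solve-∀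

  size-++ : ∀ xs ys → size (xs ++ ys) ≡ size xs + size ys
  size-++ [] ys = refl
  size-++ (node cs ∷ xs) ys = trans (cong (suc (size cs) +_) (size-++ xs ys)) (sym (+-assoc (suc (size cs)) _ _))

  twice-size-++ : ∀ xs ys → 2 * size (xs ++ ys) ≡ 2 * size xs + 2 * size ys
  twice-size-++ xs ys = trans (cong (2 *_) (size-++ xs ys)) (*-distribˡ-+ 2 (size xs) (size ys))

  injectˡ : ∀ {xs ys} → Node xs → Node (xs ++ ys)
  injectˡ root = root
  injectˡ (inside u) = inside u
  injectˡ (later u) = later (injectˡ u)

  injectʳ : ∀ xs {ys} → Node ys → Node (xs ++ ys)
  injectʳ [] u = u
  injectʳ (x ∷ xs) u = later (injectʳ xs u)

  splitNode : ∀ xs {ys} → Node (xs ++ ys) → Node xs ⊎ Node ys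
  splitNode [] w = inj₂ w
  splitNode (node cs ∷ xs) root = inj₁ root
  splitNode (node cs ∷ xs) (inside u) = inj₁ (inside u)
  splitNode (node cs ∷ xs) (later w) = Sum.map₁ later (splitNode xs w)

  data ++-View xs ys : Node (xs ++ ys) → Set where
    left  : (u : Node xs) → ++-View xs ys (injectˡ u)
    right : (u : Node ys) → ++-View xs ys (injectʳ xs u)

  ++-view : ∀ xs {ys} (w : Node (xs ++ ys)) → ++-View xs ys w
  ++-view [] w = right w
  ++-view (node cs ∷ xs) root = left root
  ++-view (node cs ∷ xs) (inside u) = left (inside u)
  ++-view (node cs ∷ xs) (later w) with ++-view xs w
  ... | left u = left (later u)
  ... | right u = right u

  splitNode-injectˡ : ∀ xs {ys} (u : Node xs) → splitNode xs {ys} (injectˡ u) ≡ inj₁ u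
  splitNode-injectˡ (node cs ∷ xs) root = refl
  splitNode-injectˡ (node cs ∷ xs) (inside u) = refl
  splitNode-injectˡ (node cs ∷ xs) {ys} (later u) rewrite splitNode-injectˡ xs {ys} u = refl

  splitNode-injectʳ : ∀ xs {ys} (u : Node ys) → splitNode xs (injectʳ xs u) ≡ inj₂ u
  splitNode-injectʳ [] u = refl
  splitNode-injectʳ (node cs ∷ xs) u rewrite splitNode-injectʳ xs u = refl

  -- Deleting the root of node cs ∷ ts leaves the forest cs ++ ts; this maps its nodes back.
  unsplice : ∀ cs ts → Node (cs ++ ts) → Node (node cs ∷ ts)
  unsplice cs ts w = [ inside , later ] (splitNode cs w)

  unsplice-injectˡ : ∀ cs ts (u : Node cs) → unsplice cs ts (injectˡ u) ≡ inside u
  unsplice-injectˡ cs ts u rewrite splitNode-injectˡ cs {ts} u = refl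

  unsplice-injectʳ : ∀ cs ts (u : Node ts) → unsplice cs ts (injectʳ cs u) ≡ later u
  unsplice-injectʳ cs ts u rewrite splitNode-injectʳ cs u = refl

  oF-injectˡ : ∀ {xs ys} (u : Node xs) → oF (injectˡ {xs} {ys} u) ≡ oF u
  oF-injectˡ root = refl
  oF-injectˡ (inside u) = refl
  oF-injectˡ (later {node cs} u) = cong (2 * size cs + 2 +_) (oF-injectˡ u)

  cF-injectˡ : ∀ {xs ys} (u : Node xs) → cF (injectˡ {xs} {ys} u) ≡ cF u
  cF-injectˡ {node cs ∷ _} root = refl
  cF-injectˡ (inside u) = refl
  cF-injectˡ (later {node cs} u) = cong (2 * size cs + 2 +_) (cF-injectˡ u)

  shift-injectʳ : ∀ xs {ys} (pos : ∀ {F} → Node F → ℕ) →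
    (∀ {cs ts} (u : Node ts) → pos (later {node cs} u) ≡ 2 * size cs + 2 + pos u) →
    (u : Node ys) → pos (injectʳ xs u) ≡ 2 * size xs + pos u
  shift-injectʳ [] pos pos-later u = refl
  shift-injectʳ (node cs ∷ xs) pos pos-later u = begin
    pos (later {node cs} (injectʳ xs u))      ≡⟨ pos-later (injectʳ xs u) ⟩
    2 * size cs + 2 + pos (injectʳ xs u)     ≡⟨ cong (2 * size cs + 2 +_) (shift-injectʳ xs pos pos-later u) ⟩
    2 * size cs + 2 + (2 * size xs + pos u)  ≡⟨ sym (+-assoc (2 * size cs + 2) _ _) ⟩
    2 * size cs + 2 + 2 * size xs + pos u    ≡⟨ cong (_+ pos u) (sym (twice-size-∷ cs xs)) ⟩
    2 * size (node cs ∷ xs) + pos u          ∎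
    where open ≡-Reasoning

  oF-injectʳ : ∀ xs {ys} (u : Node ys) → oF (injectʳ xs u) ≡ 2 * size xs + oF u
  oF-injectʳ xs = shift-injectʳ xs oF (λ _ → refl)

  cF-injectʳ : ∀ xs {ys} (u : Node ys) → cF (injectʳ xs u) ≡ 2 * size xs + cF u
  cF-injectʳ xs = shift-injectʳ xs cF (λ _ → refl)

  a+2+b≡2+a+b : ∀ a b → a + 2 + b ≡ suc (suc (a + b))
  a+2+b≡2+a+b = solve-∀

  a+2+b≡1+a+1+b : ∀ a b → a + 2 + b ≡ suc (a + suc b)
  a+2+b≡1+a+1+b = solve-∀

  a<a+2+b : ∀ a b → suc a < a + 2 + b
  a<a+2+b a b = ≤-trans (≤-reflexive (+-comm 2 a)) (m≤m+n (a + 2) b)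

  inside-bound : ∀ {o a} b → o < a → suc o < a + 2 + b
  inside-bound b o<a = <-trans (s≤s o<a) (a<a+2+b _ b)

  oF< : ∀ {F} (u : Node F) → oF u < 2 * size F
  oF< {node cs ∷ ts} root = s≤s z≤n
  oF< {node cs ∷ ts} (inside u) rewrite twice-size-∷ cs ts = inside-bound (2 * size ts) (oF< u)
  oF< {node cs ∷ ts} (later u) rewrite twice-size-∷ cs ts = +-monoʳ-< (2 * size cs + 2) (oF< u)

  cF< : ∀ {F} (u : Node F) → cF u < 2 * size F
  cF< {node cs ∷ ts} root rewrite twice-size-∷ cs ts = a<a+2+b (2 * size cs) (2 * size ts)
  cF< {node cs ∷ ts} (inside u) rewrite twice-size-∷ cs ts = inside-bound (2 * size ts) (cF< u)
  cF< {node cs ∷ ts} (later u) rewrite twice-size-∷ cs ts = +-monoʳ-< (2 * size cs + 2) (cF< u)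

  oF≢cF : ∀ {F} (u v : Node F) → oF u ≢ cF v
  oF≢cF {node cs ∷ ts} root (later v) = <⇒≢ (<-trans (s≤s z≤n) (a<a+2+b (2 * size cs) (cF v)))
  oF≢cF {node cs ∷ ts} (inside u) root = <⇒≢ (s≤s (oF< u))
  oF≢cF (inside u) (inside v) e = oF≢cF u v (suc-injective e)
  oF≢cF {node cs ∷ ts} (inside u) (later v) = <⇒≢ (inside-bound (cF v) (oF< u))
  oF≢cF {node cs ∷ ts} (later u) root = ≢-sym (<⇒≢ (a<a+2+b (2 * size cs) (oF u)))
  oF≢cF {node cs ∷ ts} (later u) (inside v) = ≢-sym (<⇒≢ (inside-bound (oF u) (cF< v)))
  oF≢cF {node cs ∷ ts} (later u) (later v) e = oF≢cF u v (+-cancelˡ-≡ (2 * size cs + 2) _ _ e)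

  cF-injective : ∀ {F} (u v : Node F) → cF u ≡ cF v → u ≡ v
  cF-injective root root _ = refl
  cF-injective {node cs ∷ ts} root (inside v) e = ⊥-elim (<⇒≢ (cF< v) (sym (suc-injective e)))
  cF-injective {node cs ∷ ts} root (later v) e = ⊥-elim (<⇒≢ (a<a+2+b (2 * size cs) (cF v)) e)
  cF-injective {node cs ∷ ts} (inside u) root e = ⊥-elim (<⇒≢ (cF< u) (suc-injective e))
  cF-injective (inside u) (inside v) e = cong inside (cF-injective u v (suc-injective e))
  cF-injective {node cs ∷ ts} (inside u) (later v) e = ⊥-elim (<⇒≢ (inside-bound (cF v) (cF< u)) e)
  cF-injective {node cs ∷ ts} (later u) root e = ⊥-elim (<⇒≢ (a<a+2+b (2 * size cs) (cF u)) (sym e))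
  cF-injective {node cs ∷ ts} (later u) (inside v) e = ⊥-elim (<⇒≢ (inside-bound (cF u) (cF< v)) (sym e))
  cF-injective {node cs ∷ ts} (later u) (later v) e = cong later (cF-injective u v (+-cancelˡ-≡ (2 * size cs + 2) _ _ e))

  oF≡0⇒root : ∀ {cs ts} (v : Node (node cs ∷ ts)) → oF v ≡ 0 → v ≡ root
  oF≡0⇒root root _ = refl
  oF≡0⇒root {cs} (later v) e = ⊥-elim (<⇒≢ (<-trans (s≤s z≤n) (a<a+2+b (2 * size cs) (oF v))) (sym e))

  position-of-node : ∀ F x → x < 2 * size F → Σ[ u ∈ Node F ] (x ≡ oF u ⊎ x ≡ cF u)
  position-of-node (node cs ∷ ts) zero _ = root , inj₁ refl
  position-of-node (node cs ∷ ts) (suc x) x< with <-cmp x (2 * size cs)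
  ... | tri< x<A _ _ with position-of-node cs x x<A
  ...   | u , e = inside u , Sum.map (cong suc) (cong suc) e
  position-of-node (node cs ∷ ts) (suc x) x< | tri≈ _ x≡A _ = root , inj₂ (cong suc x≡A)
  position-of-node (node cs ∷ ts) (suc x) x< | tri> _ _ A<x =
    later u , Sum.map (trans x≡) (trans x≡) (Sum.map (cong (A + 2 +_)) (cong (A + 2 +_)) e)
    where
    A = 2 * size cs
    k = x ∸ suc A
    x≡ : suc x ≡ A + 2 + k
    x≡ = trans (cong suc (sym (m+[n∸m]≡n A<x))) (sym (a+2+b≡2+a+b A k))
    k< : k < 2 * size ts
    k< = +-cancelˡ-< (A + 2) k (2 * size ts) (subst₂ _<_ x≡ (twice-size-∷ cs ts) x<)
    u = proj₁ (position-of-node ts k k<)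
    e = proj₂ (position-of-node ts k k<)

  label-cong : ∀ F {f g : Node F → ℕ} → (∀ u → f u ≡ g u) → label F f ≡ label F g
  label-cong [] _ = refl
  label-cong (node cs ∷ ts) f≗g =
    cong₂ _∷_ (cong₂ lnode (f≗g root) (label-cong cs (f≗g ∘ inside))) (label-cong ts (f≗g ∘ later))

  label-++ : ∀ xs {ys} (f : Node (xs ++ ys) → ℕ) →
    label (xs ++ ys) f ≡ label xs (f ∘ injectˡ) ++ label ys (f ∘ injectʳ xs)
  label-++ [] f = refl
  label-++ (node cs ∷ xs) f = cong (lnode (f root) (label cs (f ∘ inside)) ∷_) (label-++ xs (f ∘ later))

  PL-++ : ∀ ts us → PL (ts ++ us) ≡ PL ts ++ PL us
  PL-++ [] us = refl
  PL-++ (t ∷ ts) us = trans (cong (PLT t ++_) (PL-++ ts us)) (sym (++-assoc (PLT t) (PL ts) (PL us)))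

  Pλ-unsplice : ∀ cs ts (μ : Node (node cs ∷ ts) → ℕ) →
    Pλ (cs ++ ts) (μ ∘ unsplice cs ts) ≡ Pλ cs (μ ∘ inside) ++ Pλ ts (μ ∘ later)
  Pλ-unsplice cs ts μ = begin
    PL (label (cs ++ ts) (μ ∘ unsplice cs ts))
      ≡⟨ cong PL (label-++ cs (μ ∘ unsplice cs ts)) ⟩
    PL (label cs (μ ∘ unsplice cs ts ∘ injectˡ) ++ label ts (μ ∘ unsplice cs ts ∘ injectʳ cs))
      ≡⟨ cong₂ (λ X Y → PL (X ++ Y)) (label-cong cs (cong μ ∘ unsplice-injectˡ cs ts))
                                     (label-cong ts (cong μ ∘ unsplice-injectʳ cs ts)) ⟩
    PL (label cs (μ ∘ inside) ++ label ts (μ ∘ later))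
      ≡⟨ PL-++ (label cs (μ ∘ inside)) _ ⟩
    Pλ cs (μ ∘ inside) ++ Pλ ts (μ ∘ later) ∎
    where open ≡-Reasoning

  length-Pλ : ∀ F (μ : Node F → ℕ) → length (Pλ F μ) ≡ 2 * size F
  length-Pλ [] μ = refl
  length-Pλ (node cs ∷ ts) μ = begin
    length ((opn , μ root) ∷ (Pλ cs (μ ∘ inside) ++ (cls , μ root) ∷ []) ++ Pλ ts (μ ∘ later))
      ≡⟨ cong suc (length-++ (Pλ cs (μ ∘ inside) ++ (cls , μ root) ∷ [])) ⟩
    suc (length (Pλ cs (μ ∘ inside) ++ (cls , μ root) ∷ []) + length (Pλ ts (μ ∘ later)))
      ≡⟨ cong (λ n → suc (n + length (Pλ ts (μ ∘ later)))) (length-++ (Pλ cs (μ ∘ inside))) ⟩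
    suc (length (Pλ cs (μ ∘ inside)) + 1 + length (Pλ ts (μ ∘ later)))
      ≡⟨ cong₂ (λ a b → suc (a + 1 + b)) (length-Pλ cs (μ ∘ inside)) (length-Pλ ts (μ ∘ later)) ⟩
    suc (2 * size cs + 1 + 2 * size ts)
      ≡⟨ arith (2 * size cs) (2 * size ts) ⟩
    2 * size cs + 2 + 2 * size ts
      ≡⟨ twice-size-∷ cs ts ⟨
    2 * size (node cs ∷ ts) ∎
    where
    open ≡-Reasoning
    arith : ∀ a b → suc (a + 1 + b) ≡ a + 2 + b
    arith = solve-∀

  length-P : ∀ F → length (P F) ≡ 2 * size F
  length-P [] = refl
  length-P (node cs ∷ ts) = begin
    suc (length (P cs ++ cls ∷ P ts))       ≡⟨ cong suc (length-++ (P cs)) ⟩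
    suc (length (P cs) + suc (length (P ts))) ≡⟨ cong₂ (λ a b → suc (a + suc b)) (length-P cs) (length-P ts) ⟩
    suc (2 * size cs + suc (2 * size ts))   ≡⟨ arith (2 * size cs) (2 * size ts) ⟩
    2 * size cs + 2 + 2 * size ts           ≡⟨ twice-size-∷ cs ts ⟨
    2 * size (node cs ∷ ts)                 ∎
    where
    open ≡-Reasoning
    arith : ∀ a b → suc (a + suc b) ≡ a + 2 + b
    arith = solve-∀

  subtree-cong : ∀ F {f g : Node F → ℕ} → (∀ u → f u ≡ g u) → ∀ u → subtree F f u ≡ subtree F g u
  subtree-cong (node cs ∷ ts) f≗g root = cong₂ lnode (f≗g root) (label-cong cs (f≗g ∘ inside))
  subtree-cong (node cs ∷ ts) f≗g (inside u) = subtree-cong cs (f≗g ∘ inside) u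
  subtree-cong (node cs ∷ ts) f≗g (later u) = subtree-cong ts (f≗g ∘ later) u

  subtree-injectˡ : ∀ xs {ys} (f : Node (xs ++ ys) → ℕ) (u : Node xs) →
    subtree (xs ++ ys) f (injectˡ u) ≡ subtree xs (f ∘ injectˡ) u
  subtree-injectˡ (node cs ∷ xs) f root = refl
  subtree-injectˡ (node cs ∷ xs) f (inside u) = refl
  subtree-injectˡ (node cs ∷ xs) f (later u) = subtree-injectˡ xs (f ∘ later) u

  subtree-injectʳ : ∀ xs {ys} (f : Node (xs ++ ys) → ℕ) (u : Node ys) →
    subtree (xs ++ ys) f (injectʳ xs u) ≡ subtree ys (f ∘ injectʳ xs) u
  subtree-injectʳ [] f u = refl
  subtree-injectʳ (node cs ∷ xs) f u = subtree-injectʳ xs (f ∘ later) u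

  subtree-unsplice : ∀ cs ts (μ : Node (node cs ∷ ts) → ℕ) (w : Node (cs ++ ts)) →
    subtree (cs ++ ts) (μ ∘ unsplice cs ts) w ≡ subtree (node cs ∷ ts) μ (unsplice cs ts w)
  subtree-unsplice cs ts μ w with ++-view cs {ts} w
  ... | left u = begin
    subtree (cs ++ ts) (μ ∘ unsplice cs ts) (injectˡ u)  ≡⟨ subtree-injectˡ cs _ u ⟩
    subtree cs (μ ∘ unsplice cs ts ∘ injectˡ) u         ≡⟨ subtree-cong cs (cong μ ∘ unsplice-injectˡ cs ts) u ⟩
    subtree cs (μ ∘ inside) u                           ≡⟨ cong (subtree _ μ) (unsplice-injectˡ cs ts u) ⟨
    subtree (node cs ∷ ts) μ (unsplice cs ts (injectˡ u)) ∎
    where open ≡-Reasoning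
  ... | right u = begin
    subtree (cs ++ ts) (μ ∘ unsplice cs ts) (injectʳ cs u)  ≡⟨ subtree-injectʳ cs _ u ⟩
    subtree ts (μ ∘ unsplice cs ts ∘ injectʳ cs) u         ≡⟨ subtree-cong ts (cong μ ∘ unsplice-injectʳ cs ts) u ⟩
    subtree ts (μ ∘ later) u                               ≡⟨ cong (subtree _ μ) (unsplice-injectʳ cs ts u) ⟨
    subtree (node cs ∷ ts) μ (unsplice cs ts (injectʳ cs u)) ∎
    where open ≡-Reasoning

  subP-unsplice : ∀ cs ts (μ : Node (node cs ∷ ts) → ℕ) k (w : Node (cs ++ ts)) →
    subP (cs ++ ts) (μ ∘ unsplice cs ts) k w ≡ subP (node cs ∷ ts) μ k (unsplice cs ts w)
  subP-unsplice cs ts μ k w = cong (λ t → PL (trunc k (t ∷ []))) (subtree-unsplice cs ts μ w)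

  -- Edit scripts

  data Script : Forest → Forest → Set where
    nil    : Script [] []
    delete : ∀ {cs ts G} → Script (cs ++ ts) G → Script (node cs ∷ ts) G
    insert : ∀ {F ds us} → Script F (ds ++ us) → Script F (node ds ∷ us)
    pair   : ∀ {cs ts ds us} → Script cs ds → Script ts us → Script (node cs ∷ ts) (node ds ∷ us)

  -- Each operation at depth δ (the number of pairs above it) has weight w δ; a pair (u , v)
  -- moreover pays c u v per unit of weight.
  weighted : ∀ {F G} → (ℕ → ℕ) → Script F G → (Node F → Node G → ℕ) → ℕ
  weighted w nil c = 0
  weighted w (delete {cs} {ts} s) c = w 0 + weighted w s (c ∘ unsplice cs ts)
  weighted w (insert {ds = ds} {us} s) c = w 0 + weighted w s (λ u → c u ∘ unsplice ds us)
  weighted w (pair s t) c =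
    c root root * w 0 + weighted (w ∘ suc) s (λ u v → c (inside u) (inside v))
                      + weighted w t (λ u v → c (later u) (later v))

  cost : ∀ {F G} → Script F G → (Node F → Node G → ℕ) → ℕ
  cost = weighted (λ _ → 1)

  weighted-mono : ∀ {F G} (s : Script F G) {w w' c c'} → (∀ δ → w δ ≤ w' δ) → (∀ u v → c u v ≤ c' u v) →
    weighted w s c ≤ weighted w' s c'
  weighted-mono nil w≤ c≤ = z≤n
  weighted-mono (delete s) w≤ c≤ = +-mono-≤ (w≤ 0) (weighted-mono s w≤ (λ u → c≤ _))
  weighted-mono (insert s) w≤ c≤ = +-mono-≤ (w≤ 0) (weighted-mono s w≤ (λ u v → c≤ u _))
  weighted-mono (pair s t) w≤ c≤ =
    +-mono-≤ (+-mono-≤ (*-mono-≤ (c≤ root root) (w≤ 0))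
                       (weighted-mono s (w≤ ∘ suc) (λ u v → c≤ (inside u) (inside v))))
             (weighted-mono t w≤ (λ u v → c≤ (later u) (later v)))

  weighted-+ : ∀ {F G} (s : Script F G) w w' c →
    weighted (λ δ → w δ + w' δ) s c ≡ weighted w s c + weighted w' s c
  weighted-+ nil w w' c = refl
  weighted-+ (delete s) w w' c rewrite weighted-+ s w w' (c ∘ unsplice _ _) = +-interchange (w 0) (w' 0) _ _
  weighted-+ (insert s) w w' c rewrite weighted-+ s w w' (λ u → c u ∘ unsplice _ _) = +-interchange (w 0) (w' 0) _ _
  weighted-+ (pair s t) w w' c
    rewrite weighted-+ s (w ∘ suc) (w' ∘ suc) (λ u v → c (inside u) (inside v))
          | weighted-+ t w w' (λ u v → c (later u) (later v)) = arith (c root root) (w 0) (w' 0) _ _ _ _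
    where
    arith : ∀ m a b x x' y y' → m * (a + b) + (x + x') + (y + y') ≡ m * a + x + y + (m * b + x' + y')
    arith = solve-∀

  weighted-*ˡ : ∀ {F G} (s : Script F G) n w c → weighted (λ δ → n * w δ) s c ≡ n * weighted w s c
  weighted-*ˡ nil n w c = sym (*-zeroʳ n)
  weighted-*ˡ (delete s) n w c rewrite weighted-*ˡ s n w (c ∘ unsplice _ _) = sym (*-distribˡ-+ n (w 0) _)
  weighted-*ˡ (insert s) n w c rewrite weighted-*ˡ s n w (λ u → c u ∘ unsplice _ _) = sym (*-distribˡ-+ n (w 0) _)
  weighted-*ˡ (pair s t) n w c
    rewrite weighted-*ˡ s n (w ∘ suc) (λ u v → c (inside u) (inside v))
          | weighted-*ˡ t n w (λ u v → c (later u) (later v)) = arith (c root root) n (w 0) _ _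
    where
    arith : ∀ m n a x y → m * (n * a) + n * x + n * y ≡ n * (m * a + x + y)
    arith = solve-∀

  -- Look-ahead labels

  _≟ᴮ_ : DecidableEquality Bracket
  opn ≟ᴮ opn = yes refl
  opn ≟ᴮ cls = no λ ()
  cls ≟ᴮ opn = no λ ()
  cls ≟ᴮ cls = yes refl

  _≟ˢ_ : DecidableEquality (List Sym)
  _≟ˢ_ = ≡-dec (×-≡-dec _≟ᴮ_ _≟ℕ_)

  differs : ∀ {A : Set} → Dec A → ℕ
  differs (yes _) = 0
  differs (no _) = 1

  differs-≤ : ∀ {A : Set} (a? : Dec A) {n} → (n ≡ 0 → A) → differs a? ≤ n
  differs-≤ (yes _) _ = z≤n
  differs-≤ (no ¬a) {zero} n≡0⇒a = ⊥-elim (¬a (n≡0⇒a refl))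
  differs-≤ (no _) {suc n} _ = s≤s z≤n

  ≤-differs : ∀ {A : Set} (a? : Dec A) {n} → n ≤ 1 → (A → n ≡ 0) → n ≤ differs a?
  ≤-differs (yes a) _ a⇒n≡0 = ≤-reflexive (a⇒n≡0 a)
  ≤-differs (no _) n≤1 _ = n≤1

  mismatch≤1 : ∀ a b → mismatch a b ≤ 1
  mismatch≤1 a b with a ≟S b
  ... | true = z≤n
  ... | false = s≤s z≤n

  mismatch-refl : ∀ a → mismatch (opn , a) (opn , a) ≡ 0
  mismatch-refl a with a ≟ℕ a
  ... | yes _ = refl
  ... | no a≢a = ⊥-elim (a≢a refl)

  mismatch≡0⇒≡ : ∀ a b → mismatch (opn , a) (opn , b) ≡ 0 → a ≡ b
  mismatch≡0⇒≡ a b _ with a ≟ℕ b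
  mismatch≡0⇒≡ a b _ | yes a≡b = a≡b

  mismatch-cls : ∀ a b → mismatch (cls , a) (cls , b) ≡ mismatch (opn , a) (opn , b)
  mismatch-cls a b with a ≟ℕ b
  ... | yes _ = refl
  ... | no _ = refl

  labelMismatch : ∀ {F G} → (Node F → ℕ) → (Node G → ℕ) → Node F → Node G → ℕ
  labelMismatch μ ν u v = mismatch (opn , μ u) (opn , ν v)

  lookAheadMismatch : ∀ {F G} → (Node F → ℕ) → (Node G → ℕ) → ℕ → Node F → Node G → ℕ
  lookAheadMismatch {F} {G} μ ν k u v = differs (subP F μ k u ≟ˢ subP G ν k v)

  within : ℕ → ℕ → ℕ
  within zero _ = 0
  within (suc k) zero = 1
  within (suc k) (suc δ) = within k δ

  trunc-agree : ∀ {F G} k (s : Script F G) (μ : Node F → ℕ) (ν : Node G → ℕ) →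
    weighted (within k) s (labelMismatch μ ν) ≡ 0 → trunc k (label F μ) ≡ trunc k (label G ν)
  trunc-agree zero s μ ν _ = refl
  trunc-agree (suc k) nil μ ν _ = refl
  trunc-agree (suc k) (pair s t) μ ν sum≡0 = cong₂ _∷_
    (cong₂ lnode (mismatch≡0⇒≡ _ _ (trans (sym (*-identityʳ _)) (m+n≡0⇒m≡0 _ root+s≡0)))
                 (trunc-agree k s (μ ∘ inside) (ν ∘ inside) (m+n≡0⇒n≡0 _ root+s≡0)))
    (trunc-agree (suc k) t (μ ∘ later) (ν ∘ later) (m+n≡0⇒n≡0 _ sum≡0))
    where
    root+s≡0 = m+n≡0⇒m≡0 _ sum≡0

  lookAheadMismatch-root : ∀ {cs ts ds us} k (s : Script cs ds)
    (μ : Node (node cs ∷ ts) → ℕ) (ν : Node (node ds ∷ us) → ℕ) →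
    lookAheadMismatch μ ν (suc k) root root
      ≤ labelMismatch μ ν root root + weighted (within k) s (labelMismatch (μ ∘ inside) (ν ∘ inside))
  lookAheadMismatch-root k s μ ν = differs-≤ (_ ≟ˢ _) λ sum≡0 →
    cong (λ t → PL (t ∷ []))
      (cong₂ lnode (mismatch≡0⇒≡ _ _ (m+n≡0⇒m≡0 _ sum≡0)) (trunc-agree k s _ _ (m+n≡0⇒n≡0 _ sum≡0)))

  within-step : ∀ k δ → within k δ + suc (δ ⊓ k) ≤ suc (suc δ ⊓ k)
  within-step zero zero = ≤-refl
  within-step zero (suc δ) = ≤-refl
  within-step (suc k) zero = ≤-refl
  within-step (suc k) (suc δ) = ≤-trans (≤-reflexive (+-suc (within k δ) _)) (s≤s (within-step k δ))

  -- An operation at depth δ lies in the look-ahead windows of at most suc (δ ⊓ k) pairs.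
  lookAheadMismatch-cost : ∀ {F G} k (s : Script F G) (μ : Node F → ℕ) (ν : Node G → ℕ) →
    cost s (lookAheadMismatch μ ν (suc k)) ≤ weighted (λ δ → suc (δ ⊓ k)) s (labelMismatch μ ν)
  lookAheadMismatch-cost k nil μ ν = z≤n
  lookAheadMismatch-cost k (delete {cs} {ts} s) μ ν = s≤s (≤-trans
    (weighted-mono s (λ _ → ≤-refl) λ u _ →
      ≤-reflexive (cong (λ X → differs (X ≟ˢ _)) (sym (subP-unsplice cs ts μ (suc k) u))))
    (lookAheadMismatch-cost k s (μ ∘ unsplice cs ts) ν))
  lookAheadMismatch-cost k (insert {ds = ds} {us} s) μ ν = s≤s (≤-trans
    (weighted-mono s (λ _ → ≤-refl) λ _ v →
      ≤-reflexive (cong (λ Y → differs (_ ≟ˢ Y)) (sym (subP-unsplice ds us ν (suc k) v))))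
    (lookAheadMismatch-cost k s μ (ν ∘ unsplice ds us)))
  lookAheadMismatch-cost k (pair s t) μ ν = begin
    lookAheadMismatch μ ν (suc k) root root * 1 + cost s _ + cost t _
      ≤⟨ +-mono-≤ (+-mono-≤ (*-monoˡ-≤ 1 (lookAheadMismatch-root k s μ ν))
                            (lookAheadMismatch-cost k s (μ ∘ inside) (ν ∘ inside)))
                  (lookAheadMismatch-cost k t (μ ∘ later) (ν ∘ later)) ⟩
    (m + E) * 1 + W + W'
      ≡⟨ cong (_+ W') (arith m E W) ⟩
    m * 1 + (E + W) + W'
      ≡⟨ cong (λ n → m * 1 + n + W') (weighted-+ s (within k) (λ δ → suc (δ ⊓ k)) _) ⟨
    m * 1 + weighted (λ δ → within k δ + suc (δ ⊓ k)) s _ + W'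
      ≤⟨ +-monoˡ-≤ W' (+-monoʳ-≤ (m * 1) (weighted-mono s (within-step k) (λ _ _ → ≤-refl))) ⟩
    m * 1 + weighted (λ δ → suc (suc δ ⊓ k)) s _ + W' ∎
    where
    open ≤-Reasoning
    m = labelMismatch μ ν root root
    E = weighted (within k) s (labelMismatch (μ ∘ inside) (ν ∘ inside))
    W = weighted (λ δ → suc (δ ⊓ k)) s (labelMismatch (μ ∘ inside) (ν ∘ inside))
    W' = weighted (λ δ → suc (δ ⊓ k)) t (labelMismatch (μ ∘ later) (ν ∘ later))
    arith : ∀ m e w → (m + e) * 1 + w ≡ m * 1 + (e + w)
    arith = solve-∀

  labelMismatch-lookAhead : ∀ F G (λ₀ λ' : Labeling F G) d → IsLookAhead F G λ₀ d λ' → ∀ u v →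
    labelMismatch (λ' ∘ inj₁) (λ' ∘ inj₂) u v ≤ lookAheadMismatch (λ₀ ∘ inj₁) (λ₀ ∘ inj₂) d u v
  labelMismatch-lookAhead F G λ₀ λ' d isLA u v =
    ≤-differs (_ ≟ˢ _) (mismatch≤1 (opn , λ' (inj₁ u)) (opn , λ' (inj₂ v))) λ same →
    trans (cong (λ b → mismatch (opn , λ' (inj₁ u)) (opn , b)) (sym (Equivalence.from (isLA (inj₁ u) (inj₂ v)) same)))
          (mismatch-refl _)

  -- Tree alignments as edit scripts

  ParensRespected : List Step → Forest → ℕ → ℕ → Set
  ParensRespected σ G x y =
    (Deleted σ x × Deleted σ y) ⊎ (Σ[ v ∈ Node G ] Aligned σ x (oF v) × Aligned σ y (cF v))

  TreeAligned : Forest → Forest → List Step → Set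
  TreeAligned F G σ = ∀ (u : Node F) → ParensRespected σ G (oF u) (cF u)

  ScriptFor : Forest → Forest → List Step → Set
  ScriptFor F G σ =
    Σ[ s ∈ Script F G ] ∀ μ ν → editCost σ (Pλ F μ) (Pλ G ν) ≡ 2 * cost s (labelMismatch μ ν)

  removeAt-closing : ∀ (X : List Sym) z Y {p} → length X ≡ p → removeAt p ((X ++ z ∷ []) ++ Y) ≡ X ++ Y
  removeAt-closing [] z Y refl = refl
  removeAt-closing (x ∷ X) z Y refl = cong (x ∷_) (removeAt-closing X z Y refl)

  removeAt-root-closing : ∀ cs ts (μ : Node (node cs ∷ ts) → ℕ) →
    removeAt (2 * size cs) (drop 1 (Pλ (node cs ∷ ts) μ)) ≡ Pλ (cs ++ ts) (μ ∘ unsplice cs ts)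
  removeAt-root-closing cs ts μ =
    trans (removeAt-closing (Pλ cs (μ ∘ inside)) _ _ (length-Pλ cs (μ ∘ inside))) (sym (Pλ-unsplice cs ts μ))

  twice-size-unsplice : ∀ {n} cs ts → suc (suc n) ≡ 2 * size (node cs ∷ ts) → n ≡ 2 * size (cs ++ ts)
  twice-size-unsplice {n} cs ts e = begin
    n                          ≡⟨ suc-injective (suc-injective (begin
      suc (suc n)                  ≡⟨ e ⟩
      2 * size (node cs ∷ ts)      ≡⟨ twice-size-∷ cs ts ⟩
      2 * size cs + 2 + 2 * size ts ≡⟨ a+2+b≡2+a+b (2 * size cs) _ ⟩
      suc (suc (2 * size cs + 2 * size ts)) ∎)) ⟩
    2 * size cs + 2 * size ts  ≡⟨ twice-size-++ cs ts ⟨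
    2 * size (cs ++ ts)        ∎
    where open ≡-Reasoning

  ScriptsBelow : ℕ → Set
  ScriptsBelow n = ∀ F G σ → length σ ≤ n → srcLen σ ≡ 2 * size F → tgtLen σ ≡ 2 * size G →
    TreeAligned F G σ → ScriptFor F G σ

  respected-withoutDeletion-before : ∀ {σ p x y G} (δ : Deleted σ p) → x < p → y < p →
    ParensRespected (D ∷ σ) G (suc x) (suc y) → ParensRespected (withoutDeletion δ) G x y
  respected-withoutDeletion-before δ x<p y<p (inj₁ (D∷ a , D∷ b)) =
    inj₁ (Deleted-withoutDeletion-before δ a x<p , Deleted-withoutDeletion-before δ b y<p)
  respected-withoutDeletion-before δ x<p y<p (inj₂ (v , D∷ a , D∷ b)) =
    inj₂ (v , Aligned-withoutDeletion-before δ a x<p , Aligned-withoutDeletion-before δ b y<p)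

  respected-withoutDeletion-after : ∀ {σ p x y G} (δ : Deleted σ p) →
    ParensRespected (D ∷ σ) G (suc (suc (p + x))) (suc (suc (p + y))) →
    ParensRespected (withoutDeletion δ) G (p + x) (p + y)
  respected-withoutDeletion-after δ (inj₁ (D∷ a , D∷ b)) =
    inj₁ (Deleted-withoutDeletion-after δ a , Deleted-withoutDeletion-after δ b)
  respected-withoutDeletion-after δ (inj₂ (v , D∷ a , D∷ b)) =
    inj₂ (v , Aligned-withoutDeletion-after δ a , Aligned-withoutDeletion-after δ b)

  toScript-delete : ∀ {n} → ScriptsBelow n → ∀ cs ts G σ → length σ ≤ n →
    suc (srcLen σ) ≡ 2 * size (node cs ∷ ts) → tgtLen σ ≡ 2 * size G →
    TreeAligned (node cs ∷ ts) G (D ∷ σ) → ScriptFor (node cs ∷ ts) G (D ∷ σ)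
  toScript-delete rec cs ts G σ len≤ src tgt aligned with aligned root
  ... | inj₁ (_ , D∷ δ) = delete s , editCost≡
    where
    σ' = withoutDeletion δ
    aligned' : TreeAligned (cs ++ ts) G σ'
    aligned' w with ++-view cs {ts} w
    ... | left u = subst₂ (ParensRespected σ' G) (sym (oF-injectˡ u)) (sym (cF-injectˡ u))
      (respected-withoutDeletion-before δ (oF< u) (cF< u) (aligned (inside u)))
    ... | right u = subst₂ (ParensRespected σ' G) (sym (oF-injectʳ cs u)) (sym (cF-injectʳ cs u))
      (respected-withoutDeletion-after δ (subst₂ (ParensRespected (D ∷ σ) G)
        (a+2+b≡2+a+b _ (oF u)) (a+2+b≡2+a+b _ (cF u)) (aligned (later u))))
    rest = rec (cs ++ ts) G σ'
      (≤-trans (n≤1+n _) (subst (_≤ _) (sym (length-withoutDeletion δ)) len≤))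
      (twice-size-unsplice cs ts (trans (cong suc (srcLen-withoutDeletion δ)) src))
      (trans (tgtLen-withoutDeletion δ) tgt) aligned'
    s = proj₁ rest
    editCost≡ : ∀ μ ν →
      editCost (D ∷ σ) (Pλ (node cs ∷ ts) μ) (Pλ G ν) ≡ 2 * cost (delete s) (labelMismatch μ ν)
    editCost≡ μ ν = begin
      suc (editCost σ (drop 1 (Pλ (node cs ∷ ts) μ)) (Pλ G ν))
        ≡⟨ cong suc (editCost-withoutDeletion δ _ _) ⟩
      suc (suc (editCost σ' (removeAt (2 * size cs) (drop 1 (Pλ (node cs ∷ ts) μ))) (Pλ G ν)))
        ≡⟨ cong (λ X → suc (suc (editCost σ' X (Pλ G ν)))) (removeAt-root-closing cs ts μ) ⟩
      suc (suc (editCost σ' (Pλ (cs ++ ts) (μ ∘ unsplice cs ts)) (Pλ G ν)))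
        ≡⟨ cong (suc ∘ suc) (proj₂ rest (μ ∘ unsplice cs ts) ν) ⟩
      suc (suc (2 * cost s (labelMismatch (μ ∘ unsplice cs ts) ν)))
        ≡⟨ *-suc 2 _ ⟨
      2 * cost (delete s) (labelMismatch μ ν) ∎
      where open ≡-Reasoning

  Aligned-I∷⁻ : ∀ {σ x y} → Aligned (I ∷ σ) x (suc y) → Aligned σ x y
  Aligned-I∷⁻ (I∷ a) = a

  respected-withoutInsertion : ∀ {σ ds us x y} (ι : Inserted σ (2 * size ds)) →
    ParensRespected (I ∷ σ) (node ds ∷ us) x y → ParensRespected (withoutInsertion ι) (ds ++ us) x y
  respected-withoutInsertion ι (inj₁ (I∷ a , I∷ b)) =
    inj₁ (Deleted-withoutInsertion ι a , Deleted-withoutInsertion ι b)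
  respected-withoutInsertion ι (inj₂ (inside w , I∷ a , I∷ b)) = inj₂ (injectˡ w ,
    subst (Aligned _ _) (sym (oF-injectˡ w)) (Aligned-withoutInsertion-before ι a (oF< w)) ,
    subst (Aligned _ _) (sym (cF-injectˡ w)) (Aligned-withoutInsertion-before ι b (cF< w)))
  respected-withoutInsertion {ds = ds} ι (inj₂ (later w , a , b)) = inj₂ (injectʳ ds w ,
    subst (Aligned _ _) (sym (oF-injectʳ ds w))
      (Aligned-withoutInsertion-after ι (Aligned-I∷⁻ (subst (Aligned _ _) (a+2+b≡2+a+b (2 * size ds) (oF w)) a))) ,
    subst (Aligned _ _) (sym (cF-injectʳ ds w))
      (Aligned-withoutInsertion-after ι (Aligned-I∷⁻ (subst (Aligned _ _) (a+2+b≡2+a+b (2 * size ds) (cF w)) b))))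

  -- The parenthesis aligned with the closing one of the root of G would belong to a node of F
  -- whose opening parenthesis is then aligned with position 0, which an insertion step skips.
  root-closing-unaligned : ∀ F ds us σ → srcLen σ ≡ 2 * size F → TreeAligned F (node ds ∷ us) (I ∷ σ) →
    ∀ {x} → Aligned (I ∷ σ) x (cF (root {ds} {us})) → ⊥
  root-closing-unaligned F ds us σ src aligned {x} a
    with position-of-node F x (subst (x <_) src (proj₁ (Aligned-bounded a)))
  ... | u , x≡ with aligned u | x≡
  ...   | inj₁ (δ , _) | inj₁ refl = Deleted⇒¬Aligned δ a
  ...   | inj₁ (_ , δ) | inj₂ refl = Deleted⇒¬Aligned δ a
  ...   | inj₂ (v , a₁ , _) | inj₁ refl = oF≢cF v root (Aligned-functional a₁ a)
  ...   | inj₂ (v , a₁ , a₂) | inj₂ refl with cF-injective v root (Aligned-functional a₂ a)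
  ...     | refl with a₁
  ...       | ()

  toScript-insert : ∀ {n} → ScriptsBelow n → ∀ F ds us σ → length σ ≤ n →
    srcLen σ ≡ 2 * size F → suc (tgtLen σ) ≡ 2 * size (node ds ∷ us) →
    TreeAligned F (node ds ∷ us) (I ∷ σ) → ScriptFor F (node ds ∷ us) (I ∷ σ)
  toScript-insert rec F ds us σ len≤ src tgt aligned
    with Aligned-or-Inserted (I ∷ σ) {cF (root {ds} {us})} (subst (cF (root {ds} {us}) <_) (sym tgt) (cF< (root {ds} {us})))
  ... | inj₁ (_ , a) = ⊥-elim (root-closing-unaligned F ds us σ src aligned a)
  ... | inj₂ (I∷ ι) = insert s , editCost≡
    where
    σ' = withoutInsertion ι
    rest = rec F (ds ++ us) σ'
      (≤-trans (n≤1+n _) (subst (_≤ _) (sym (length-withoutInsertion ι)) len≤))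
      (trans (srcLen-withoutInsertion ι) src)
      (twice-size-unsplice ds us (trans (cong suc (tgtLen-withoutInsertion ι)) tgt))
      (respected-withoutInsertion ι ∘ aligned)
    s = proj₁ rest
    editCost≡ : ∀ μ ν →
      editCost (I ∷ σ) (Pλ F μ) (Pλ (node ds ∷ us) ν) ≡ 2 * cost (insert s) (labelMismatch μ ν)
    editCost≡ μ ν = begin
      suc (editCost σ (Pλ F μ) (drop 1 (Pλ (node ds ∷ us) ν)))
        ≡⟨ cong suc (editCost-withoutInsertion ι _ _) ⟩
      suc (suc (editCost σ' (Pλ F μ) (removeAt (2 * size ds) (drop 1 (Pλ (node ds ∷ us) ν)))))
        ≡⟨ cong (λ Y → suc (suc (editCost σ' (Pλ F μ) Y))) (removeAt-root-closing ds us ν) ⟩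
      suc (suc (editCost σ' (Pλ F μ) (Pλ (ds ++ us) (ν ∘ unsplice ds us))))
        ≡⟨ cong (suc ∘ suc) (proj₂ rest μ (ν ∘ unsplice ds us)) ⟩
      suc (suc (2 * cost s (labelMismatch μ (ν ∘ unsplice ds us))))
        ≡⟨ *-suc 2 _ ⟨
      2 * cost (insert s) (labelMismatch μ ν) ∎
      where open ≡-Reasoning

  1+t+1+n≡a+2+n : ∀ {t a} → t ≡ a → ∀ n → suc (t + suc n) ≡ a + 2 + n
  1+t+1+n≡a+2+n {a = a} refl n = sym (a+2+b≡1+a+1+b a n)

  Aligned-M∷⁻ : ∀ {σ x y} → Aligned (M ∷ σ) (suc x) y → ∃[ y' ] y ≡ suc y' × Aligned σ x y'
  Aligned-M∷⁻ (M∷ a) = _ , refl , a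

  respected-prefix : ∀ σ₁ {σ₂ ds us x y} → tgtLen σ₁ ≡ 2 * size ds → x < srcLen σ₁ → y < srcLen σ₁ →
    ParensRespected (M ∷ σ₁ ++ M ∷ σ₂) (node ds ∷ us) (suc x) (suc y) → ParensRespected σ₁ ds x y
  respected-prefix σ₁ tgt x< y< (inj₁ (M∷ a , M∷ b)) = inj₁ (Deleted-prefix σ₁ a x< , Deleted-prefix σ₁ b y<)
  respected-prefix σ₁ tgt x< y< (inj₂ (inside w , M∷ a , M∷ b)) =
    inj₂ (w , Aligned-prefix σ₁ a x< , Aligned-prefix σ₁ b y<)
  respected-prefix σ₁ {ds = ds} tgt x< y< (inj₂ (later w , a , _)) with Aligned-M∷⁻ a
  ... | y' , oF≡ , a' = ⊥-elim (<-irrefl refl (begin-strict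
    y'                           <⟨ subst (y' <_) tgt (proj₂ (Aligned-bounded (Aligned-prefix σ₁ a' x<))) ⟩
    2 * size ds                  ≤⟨ ≤-trans (m≤m+n _ (oF w)) (n≤1+n _) ⟩
    suc (2 * size ds + oF w)     ≡⟨ suc-injective (trans (sym (a+2+b≡2+a+b (2 * size ds) (oF w))) oF≡) ⟩
    y'                           ∎))
    where open ≤-Reasoning

  Aligned-beyond : ∀ σ₁ {σ₂ x y} → Aligned (M ∷ σ₁ ++ M ∷ σ₂) (suc (srcLen σ₁ + suc x)) y →
    ∃[ y' ] y ≡ suc (tgtLen σ₁ + suc y') × Aligned σ₂ x y'
  Aligned-beyond σ₁ (M∷ a) with Aligned-suffix σ₁ a
  ... | y' , refl , a' = y' , refl , a'

  oF≡⇒later : ∀ {ds us} (v : Node (node ds ∷ us)) y → oF v ≡ 2 * size ds + 2 + y →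
    Σ[ w ∈ Node us ] v ≡ later w × oF w ≡ y
  oF≡⇒later {ds} root y e = ⊥-elim (0≢1+n (trans e (a+2+b≡2+a+b (2 * size ds) y)))
  oF≡⇒later {ds} (inside w) y e = ⊥-elim (<⇒≢ (inside-bound y (oF< w)) e)
  oF≡⇒later {ds} (later w) y e = w , refl , +-cancelˡ-≡ (2 * size ds + 2) _ _ e

  respected-suffix : ∀ σ₁ {σ₂ ds us x y} → tgtLen σ₁ ≡ 2 * size ds →
    ParensRespected (M ∷ σ₁ ++ M ∷ σ₂) (node ds ∷ us) (suc (srcLen σ₁ + suc x)) (suc (srcLen σ₁ + suc y)) →
    ParensRespected σ₂ us x y
  respected-suffix σ₁ tgt (inj₁ (M∷ a , M∷ b)) = inj₁ (Deleted-suffix σ₁ a , Deleted-suffix σ₁ b)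
  respected-suffix σ₁ {ds = ds} tgt (inj₂ (v , a , b))
    with Aligned-beyond σ₁ a | Aligned-beyond σ₁ b
  ... | y' , oF≡ , a' | z' , cF≡ , b' with oF≡⇒later v y' (trans oF≡ (1+t+1+n≡a+2+n tgt y'))
  ...   | w , refl , refl =
    inj₂ (w , a' , subst (Aligned _ _) (sym (+-cancelˡ-≡ (2 * size ds + 2) _ _ (trans cF≡ (1+t+1+n≡a+2+n tgt z')))) b')

  drop-++-length : ∀ (X Y : List Sym) → drop (length X) (X ++ Y) ≡ Y
  drop-++-length [] Y = refl
  drop-++-length (x ∷ X) Y = drop-++-length X Y

  editCost-pair : ∀ σ₁ σ₂ {cs ts ds us} (μ : Node (node cs ∷ ts) → ℕ) (ν : Node (node ds ∷ us) → ℕ) →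
    srcLen σ₁ ≡ 2 * size cs → tgtLen σ₁ ≡ 2 * size ds →
    editCost (M ∷ σ₁ ++ M ∷ σ₂) (Pλ (node cs ∷ ts) μ) (Pλ (node ds ∷ us) ν)
      ≡ labelMismatch μ ν root root + (editCost σ₁ (Pλ cs (μ ∘ inside)) (Pλ ds (ν ∘ inside))
        + (labelMismatch μ ν root root + editCost σ₂ (Pλ ts (μ ∘ later)) (Pλ us (ν ∘ later))))
  editCost-pair σ₁ σ₂ {cs} {ts} {ds} {us} μ ν src tgt = begin
    m + editCost (σ₁ ++ M ∷ σ₂) ((Xc ++ (cls , a) ∷ []) ++ Xt) ((Yd ++ (cls , b) ∷ []) ++ Yu)
      ≡⟨ cong₂ (λ X Y → m + editCost (σ₁ ++ M ∷ σ₂) X Y) (++-assoc Xc _ Xt) (++-assoc Yd _ Yu) ⟩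
    m + editCost (σ₁ ++ M ∷ σ₂) (Xc ++ (cls , a) ∷ Xt) (Yd ++ (cls , b) ∷ Yu)
      ≡⟨ cong (m +_) (editCost-++ σ₁ (M ∷ σ₂) _ _) ⟩
    m + (editCost σ₁ (Xc ++ (cls , a) ∷ Xt) (Yd ++ (cls , b) ∷ Yu)
         + editCost (M ∷ σ₂) (drop (srcLen σ₁) (Xc ++ (cls , a) ∷ Xt)) (drop (tgtLen σ₁) (Yd ++ (cls , b) ∷ Yu)))
      ≡⟨ cong₂ (λ p q → m + (p + q)) (editCost-prefix σ₁ Xc _ Yd _ srcX tgtY)
           (cong₂ (editCost (M ∷ σ₂)) (trans (cong (λ n → drop n (Xc ++ (cls , a) ∷ Xt)) srcX) (drop-++-length Xc _))
                                       (trans (cong (λ n → drop n (Yd ++ (cls , b) ∷ Yu)) tgtY) (drop-++-length Yd _))) ⟩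
    m + (editCost σ₁ Xc Yd + (mismatch (cls , a) (cls , b) + editCost σ₂ Xt Yu))
      ≡⟨ cong (λ n → m + (editCost σ₁ Xc Yd + (n + editCost σ₂ Xt Yu))) (mismatch-cls a b) ⟩
    m + (editCost σ₁ Xc Yd + (m + editCost σ₂ Xt Yu)) ∎
    where
    open ≡-Reasoning
    a = μ root
    b = ν root
    m = labelMismatch μ ν root root
    Xc = Pλ cs (μ ∘ inside)
    Xt = Pλ ts (μ ∘ later)
    Yd = Pλ ds (ν ∘ inside)
    Yu = Pλ us (ν ∘ later)
    srcX : srcLen σ₁ ≡ length Xc
    srcX = trans src (sym (length-Pλ cs (μ ∘ inside)))
    tgtY : tgtLen σ₁ ≡ length Yd
    tgtY = trans tgt (sym (length-Pλ ds (ν ∘ inside)))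

  suffix-count : ∀ {p q a b} → p ≡ a → suc (p + suc q) ≡ a + 2 + b → q ≡ b
  suffix-count {q = q} p≡a e = +-cancelˡ-≡ _ q _ (trans (sym (1+t+1+n≡a+2+n p≡a q)) e)

  toScript-pair : ∀ {n} → ScriptsBelow n → ∀ cs ts ds us σ → length σ ≤ n →
    suc (srcLen σ) ≡ 2 * size (node cs ∷ ts) → suc (tgtLen σ) ≡ 2 * size (node ds ∷ us) →
    TreeAligned (node cs ∷ ts) (node ds ∷ us) (M ∷ σ) → ScriptFor (node cs ∷ ts) (node ds ∷ us) (M ∷ σ)
  toScript-pair rec cs ts ds us σ len≤ src tgt aligned with aligned root
  ... | inj₂ (v , opening , closing) with oF≡0⇒root v (Aligned-functional opening here)
  ... | refl with closing
  ... | M∷ closing' with Aligned-split closing'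
  ... | σ₁ , σ₂ , refl , src₁ , tgt₁ = pair s t , editCost≡
    where
    len≤' = subst (_≤ _) (length-++ σ₁) len≤
    aligned₁ : TreeAligned cs ds σ₁
    aligned₁ u = respected-prefix σ₁ tgt₁ (subst (oF u <_) (sym src₁) (oF< u)) (subst (cF u <_) (sym src₁) (cF< u))
      (aligned (inside u))
    aligned₂ : TreeAligned ts us σ₂
    aligned₂ u = respected-suffix σ₁ tgt₁ (subst₂ (ParensRespected (M ∷ σ₁ ++ M ∷ σ₂) (node ds ∷ us))
      (sym (1+t+1+n≡a+2+n src₁ (oF u))) (sym (1+t+1+n≡a+2+n src₁ (cF u))) (aligned (later u)))
    inner = rec cs ds σ₁ (≤-trans (m≤m+n _ _) len≤') src₁ tgt₁ aligned₁
    rest = rec ts us σ₂ (≤-trans (≤-trans (n≤1+n _) (m≤n+m _ (length σ₁))) len≤')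
      (suffix-count src₁ (trans (cong suc (sym (srcLen-++ σ₁ (M ∷ σ₂)))) (trans src (twice-size-∷ cs ts))))
      (suffix-count tgt₁ (trans (cong suc (sym (tgtLen-++ σ₁ (M ∷ σ₂)))) (trans tgt (twice-size-∷ ds us))))
      aligned₂
    s = proj₁ inner
    t = proj₁ rest
    editCost≡ : ∀ μ ν → editCost (M ∷ σ₁ ++ M ∷ σ₂) (Pλ (node cs ∷ ts) μ) (Pλ (node ds ∷ us) ν)
                          ≡ 2 * cost (pair s t) (labelMismatch μ ν)
    editCost≡ μ ν
      rewrite editCost-pair σ₁ σ₂ μ ν src₁ tgt₁
            | proj₂ inner (μ ∘ inside) (ν ∘ inside) | proj₂ rest (μ ∘ later) (ν ∘ later) =
        arith (labelMismatch μ ν root root) (cost s _) (cost t _)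
      where
      arith : ∀ m c c' → m + (2 * c + (m + 2 * c')) ≡ 2 * (m * 1 + c + c')
      arith = solve-∀

  toScript : ∀ n → ScriptsBelow n
  toScript n [] [] [] _ _ _ _ = nil , λ _ _ → refl
  toScript n [] [] (M ∷ σ) _ () _ _
  toScript n [] [] (D ∷ σ) _ () _ _
  toScript n [] [] (I ∷ σ) _ _ () _
  toScript (suc n) (node cs ∷ ts) G (D ∷ σ) (s≤s len≤) src tgt aligned =
    toScript-delete (toScript n) cs ts G σ len≤ src tgt aligned
  toScript (suc n) F (node ds ∷ us) (I ∷ σ) (s≤s len≤) src tgt aligned =
    toScript-insert (toScript n) F ds us σ len≤ src tgt aligned
  toScript (suc n) (node cs ∷ ts) (node ds ∷ us) (M ∷ σ) (s≤s len≤) src tgt aligned =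
    toScript-pair (toScript n) cs ts ds us σ len≤ src tgt aligned

  steps : ∀ {m n} → Alignment m n → List Step
  steps done = []
  steps (match A) = M ∷ steps A
  steps (del A) = D ∷ steps A
  steps (ins A) = I ∷ steps A

  srcLen-steps : ∀ {m n} (A : Alignment m n) → srcLen (steps A) ≡ m
  srcLen-steps done = refl
  srcLen-steps (match A) = cong suc (srcLen-steps A)
  srcLen-steps (del A) = cong suc (srcLen-steps A)
  srcLen-steps (ins A) = srcLen-steps A

  tgtLen-steps : ∀ {m n} (A : Alignment m n) → tgtLen (steps A) ≡ n
  tgtLen-steps done = refl
  tgtLen-steps (match A) = cong suc (tgtLen-steps A)
  tgtLen-steps (del A) = tgtLen-steps A
  tgtLen-steps (ins A) = cong suc (tgtLen-steps A)

  Aligned-steps : ∀ {m n} {A : Alignment m n} {x y} → AlignedAt A x y → Aligned (steps A) x y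
  Aligned-steps here = here
  Aligned-steps (thM a) = M∷ Aligned-steps a
  Aligned-steps (thD a) = D∷ Aligned-steps a
  Aligned-steps (thI a) = I∷ Aligned-steps a

  Deleted-steps : ∀ {m n} {A : Alignment m n} {x} → DeletedAt A x → Deleted (steps A) x
  Deleted-steps here = here
  Deleted-steps (thM δ) = M∷ Deleted-steps δ
  Deleted-steps (thD δ) = D∷ Deleted-steps δ
  Deleted-steps (thI δ) = I∷ Deleted-steps δ

  TreeAligned-steps : ∀ F G (A : Align F G) → IsTreeAlignment F G A → TreeAligned F G (steps A)
  TreeAligned-steps F G A isTA u with isTA u
  ... | inj₁ (δ , δ') = inj₁ (Deleted-steps δ , Deleted-steps δ')
  ... | inj₂ (v , a , a') = inj₂ (v , Aligned-steps a , Aligned-steps a')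

  ed≡editCost : ∀ {m n} (A : Alignment m n) X Y → length X ≡ m → length Y ≡ n → ed A X Y ≡ editCost (steps A) X Y
  ed≡editCost done X Y _ _ = refl
  ed≡editCost (match A) (a ∷ X) (b ∷ Y) eX eY with a ≟S b
  ... | true = ed≡editCost A X Y (suc-injective eX) (suc-injective eY)
  ... | false = cong suc (ed≡editCost A X Y (suc-injective eX) (suc-injective eY))
  ed≡editCost (del A) (a ∷ X) Y eX eY = cong suc (ed≡editCost A X Y (suc-injective eX) eY)
  ed≡editCost (ins A) X (b ∷ Y) eX eY = cong suc (ed≡editCost A X Y eX (suc-injective eY))

  cost-lookAhead-≤ : ∀ {F G} (s : Script F G) (λ₀ λ' : Labeling F G) k → IsLookAhead F G λ₀ (suc k) λ' →
    cost s (labelMismatch (λ' ∘ inj₁) (λ' ∘ inj₂)) ≤ suc k * cost s (labelMismatch (λ₀ ∘ inj₁) (λ₀ ∘ inj₂))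
  cost-lookAhead-≤ {F} {G} s λ₀ λ' k isLA = begin
    cost s (labelMismatch (λ' ∘ inj₁) (λ' ∘ inj₂))
      ≤⟨ weighted-mono s (λ _ → ≤-refl) (labelMismatch-lookAhead F G λ₀ λ' (suc k) isLA) ⟩
    cost s (lookAheadMismatch (λ₀ ∘ inj₁) (λ₀ ∘ inj₂) (suc k))
      ≤⟨ lookAheadMismatch-cost k s (λ₀ ∘ inj₁) (λ₀ ∘ inj₂) ⟩
    weighted (λ δ → suc (δ ⊓ k)) s (labelMismatch (λ₀ ∘ inj₁) (λ₀ ∘ inj₂))
      ≤⟨ weighted-mono s (λ δ → ≤-trans (s≤s (m⊓n≤n δ k)) (≤-reflexive (sym (*-identityʳ _)))) (λ _ _ → ≤-refl) ⟩
    weighted (λ _ → suc k * 1) s (labelMismatch (λ₀ ∘ inj₁) (λ₀ ∘ inj₂))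
      ≡⟨ weighted-*ˡ s (suc k) (λ _ → 1) _ ⟩
    suc k * cost s (labelMismatch (λ₀ ∘ inj₁) (λ₀ ∘ inj₂)) ∎
    where open ≤-Reasoning

  tree-alignment-script : ∀ F G (A : Align F G) → IsTreeAlignment F G A → Σ[ s ∈ Script F G ]
    ∀ (μ : Labeling F G) →
    ed A (Pλ F (μ ∘ inj₁)) (Pλ G (μ ∘ inj₂)) ≡ 2 * cost s (labelMismatch (μ ∘ inj₁) (μ ∘ inj₂))
  tree-alignment-script F G A isTA = proj₁ script , λ μ →
    trans (ed≡editCost A _ _ (trans (length-Pλ F _) (sym (length-P F))) (trans (length-Pλ G _) (sym (length-P G))))
          (proj₂ script (μ ∘ inj₁) (μ ∘ inj₂))
    where
    script = toScript _ F G (steps A) ≤-refl (trans (srcLen-steps A) (length-P F))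
                      (trans (tgtLen-steps A) (length-P G)) (TreeAligned-steps F G A isTA)

  ed-lookAhead-≤ : ∀ F G (λ₀ : Labeling F G) (A : Align F G) → IsTreeAlignment F G A → ∀ d → 1 ≤ d →
    ∀ λ' → IsLookAhead F G λ₀ d λ' →
    ed A (Pλ F (λ' ∘ inj₁)) (Pλ G (λ' ∘ inj₂)) ≤ d * ed A (Pλ F (λ₀ ∘ inj₁)) (Pλ G (λ₀ ∘ inj₂))
  ed-lookAhead-≤ F G λ₀ A isTA (suc k) _ λ' isLA with tree-alignment-script F G A isTA
  ... | s , ed≡ rewrite ed≡ λ' | ed≡ λ₀ =
    ≤-trans (*-monoʳ-≤ 2 (cost-lookAhead-≤ s λ₀ λ' k isLA))
            (≤-reflexive (*-left-comm 2 (suc k) (cost s (labelMismatch (λ₀ ∘ inj₁) (λ₀ ∘ inj₂)))))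

open EditScripts using (ed-lookAhead-≤)
open import Data.Nat using (ℕ; _≤_)
import Data.Nat as ℕ
open import Data.Integer using (+_; +≤+) renaming (_≤_ to _≤ℤ_; _*_ to _*ℤ_)
import Data.Integer.Properties as ℤ
open import Data.Rational using (_/_; _*_; toℚᵘ) renaming (_≤_ to _≤ℚ_)
open import Data.Rational.Properties using (toℚᵘ-cancel-≤; toℚᵘ-fromℚᵘ; toℚᵘ-homo-*)
open import Data.Rational.Unnormalised using (mkℚᵘ; *≤*; _≃_) renaming (_*_ to _*ᵘ_)
import Data.Rational.Unnormalised.Properties as ℚᵘ
open import Relation.Binary.PropositionalEquality using (subst)

half-≤-scaled : ∀ m n d → m ≤ d ℕ.* n → (+ m) / 2 ≤ℚ ((+ d) / 1) * ((+ n) / 2)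
half-≤-scaled m n d m≤dn = toℚᵘ-cancel-≤ (ℚᵘ.≤-respˡ-≃ (ℚᵘ.≃-sym (toℚᵘ-fromℚᵘ (mkℚᵘ (+ m) 1)))
  (ℚᵘ.≤-respʳ-≃ (ℚᵘ.≃-sym toℚᵘ-rhs) (*≤* (ℤ.*-monoʳ-≤-nonNeg (+ 2) m≤dn-ℤ))))
  where
  m≤dn-ℤ : + m ≤ℤ + d *ℤ + n
  m≤dn-ℤ = subst (+ m ≤ℤ_) (ℤ.pos-* d n) (+≤+ m≤dn)
  toℚᵘ-rhs : toℚᵘ (((+ d) / 1) * ((+ n) / 2)) ≃ mkℚᵘ (+ d) 0 *ᵘ mkℚᵘ (+ n) 1
  toℚᵘ-rhs = ℚᵘ.≃-trans (toℚᵘ-homo-* ((+ d) / 1) ((+ n) / 2))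
                        (ℚᵘ.*-cong (toℚᵘ-fromℚᵘ (mkℚᵘ (+ d) 0)) (toℚᵘ-fromℚᵘ (mkℚᵘ (+ n) 1)))

lemma4p2 : (F G : Forest) (λ₀ : Labeling F G) (A : Align F G) →
           IsTreeAlignment F G A →
           (d : ℕ) → 1 ≤ d →
           (λ' : Labeling F G) → IsLookAhead F G λ₀ d λ' →
           ted F G λ' A ≤ℚ ((+ d) / 1) * ted F G λ₀ A
lemma4p2 F G λ₀ A isTA d 1≤d λ' isLA = half-≤-scaled _ _ d (ed-lookAhead-≤ F G λ₀ A isTA d 1≤d λ' isLA)
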